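{- Let $G$ be a graph with $k\geq 2$ connected components $G_1,\dots,G_k$. Then \[\deg(G)=\sum_{i=1}^{k}\deg(G_i)+\sum_{1\leq i<j\leq k}2\,\|G_i\|\,\|G_j\|,\] where $\|H\|$ denotes the number of edges of $H$.
   Context: A 2-switch acting on a graph $G$ is given by distinct vertices $a,b,c,d$ with $ab,cd\in E(G)$, $ac,bd\notin E(G)$, and transforms $G$ into $(G-\{ab,cd\})+\{ac,bd\}$. The 2-switch-degree $\deg(G)$ is the number of distinct graphs obtainable from $G$ by a single 2-switch (each component $G_i$ being regarded as a graph on its own vertex set). -}

module Defs where

open import Data.Bool using (Bool; true; false; _∧_; _∨_; not; T; if_then_else_)
open import Data.Bool.Properties using (T?)
open import Data.Nat using (ℕ; _+_; _*_; _<ᵇ_)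
open import Data.Fin using (Fin; toℕ; _≟_)
open import Data.Fin.Subset using (Subset)
open import Data.Product using (_×_; _,_; ∃)
open import Data.List using (List; length; map; filter; cartesianProduct; allFin; deduplicate)
open import Data.Nat.ListAction using (sum)
open import Data.Vec using (Vec; lookup; tabulate)
open import Data.Vec.Properties using (≡-dec)
import Data.Bool.Properties as BoolP
open import Relation.Nullary.Decidable using (⌊_⌋)
open import Relation.Binary.PropositionalEquality using (_≡_)
open import Relation.Binary.Construct.Closure.ReflexiveTransitive using (Star)

Adj : ℕ → Set
Adj n = Vec (Vec Bool n) n

adj : ∀ {n} → Adj n → Fin n → Fin n → Bool
adj M u v = lookup (lookup M u) v

IsSimple : ∀ {n} → Adj n → Set
IsSimple M = (∀ u v → adj M u v ≡ adj M v u) × (∀ u → adj M u u ≡ false)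

_==_ : ∀ {n} → Fin n → Fin n → Bool
u == v = ⌊ u ≟ v ⌋

samePair : ∀ {n} → Fin n → Fin n → Fin n → Fin n → Bool
samePair u v x y = ((u == x) ∧ (v == y)) ∨ ((u == y) ∧ (v == x))

switch : ∀ {n} → Adj n → Fin n → Fin n → Fin n → Fin n → Adj n
switch M a b c d = tabulate λ u → tabulate λ v →
  if samePair u v a c ∨ samePair u v b d then true
  else if samePair u v a b ∨ samePair u v c d then false
  else adj M u v

inS : ∀ {n} → Subset n → Fin n → Bool
inS S u = lookup S u

isSwitch : ∀ {n} → Subset n → Adj n → Fin n → Fin n → Fin n → Fin n → Bool
isSwitch S M a b c d =
  inS S a ∧ inS S b ∧ inS S c ∧ inS S d ∧
  not (a == b) ∧ not (a == c) ∧ not (a == d) ∧ not (b == c) ∧ not (b == d) ∧ not (c == d) ∧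
  adj M a b ∧ adj M c d ∧ not (adj M a c) ∧ not (adj M b d)

quadruples : ∀ n → List (Fin n × Fin n × Fin n × Fin n)
quadruples n = cartesianProduct (allFin n) (cartesianProduct (allFin n) (cartesianProduct (allFin n) (allFin n)))

isSwitchQ : ∀ {n} → Subset n → Adj n → Fin n × Fin n × Fin n × Fin n → Bool
isSwitchQ S M (a , b , c , d) = isSwitch S M a b c d

switchQ : ∀ {n} → Adj n → Fin n × Fin n × Fin n × Fin n → Adj n
switchQ M (a , b , c , d) = switch M a b c d

switchResults : ∀ {n} → Subset n → Adj n → List (Adj n)
switchResults S M = map (switchQ M) (filter (λ q → T? (isSwitchQ S M q)) (quadruples _))

deg : ∀ {n} → Subset n → Adj n → ℕ
deg S M = length (deduplicate (≡-dec (≡-dec BoolP._≟_)) (switchResults S M))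

edgeCount : ∀ {n} → Subset n → Adj n → ℕ
edgeCount {n} S M = length (filter (λ p → T? (edgeQ p)) (cartesianProduct (allFin n) (allFin n)))
  where
  edgeQ : Fin n × Fin n → Bool
  edgeQ (u , v) = (toℕ u <ᵇ toℕ v) ∧ inS S u ∧ inS S v ∧ adj M u v

full : ∀ {n} → Subset n
full = tabulate λ _ → true

Adjacent : ∀ {n} → Adj n → Fin n → Fin n → Set
Adjacent M u v = adj M u v ≡ true

Connected : ∀ {n} → Adj n → Fin n → Fin n → Set
Connected M = Star (Adjacent M)

-- comp : Fin n → Fin k labels the connected components of G by 1..k:
-- every label is used, adjacent vertices share a label, and vertices with
-- the same label are joined by a walk. Hence the classes are exactly the
-- k connected components.
IsComponentLabelling : ∀ {n k} → Adj n → (Fin n → Fin k) → Set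
IsComponentLabelling M comp =
  (∀ i → ∃ λ v → comp v ≡ i) ×
  (∀ u v → adj M u v ≡ true → comp u ≡ comp v) ×
  (∀ u v → comp u ≡ comp v → Connected M u v)

compVerts : ∀ {n k} → (Fin n → Fin k) → Fin k → Subset n
compVerts comp i = tabulate λ v → comp v == i

compAdj : ∀ {n k} → Adj n → (Fin n → Fin k) → Fin k → Adj n
compAdj M comp i = tabulate λ u → tabulate λ v → (comp u == i) ∧ (comp v == i) ∧ adj M u v

sumPairs : ∀ {k} → (Fin k → Fin k → ℕ) → ℕ
sumPairs {k} f = sum (map (λ p → g p) (filter (λ p → T? (lt p)) (cartesianProduct (allFin k) (allFin k))))
  where
  lt : Fin k × Fin k → Bool
  lt (i , j) = toℕ i <ᵇ toℕ j
  g : Fin k × Fin k → ℕ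
  g (i , j) = f i j

sumFin : ∀ {k} → (Fin k → ℕ) → ℕ
sumFin {k} f = sum (map f (allFin k))

-- A 2-switch removes edges ab, cd and adds ac, bd; it changes no entry outside {a, b, c, d},
-- while the removed edges ab and cd always change, so the resulting graph determines the
-- vertex set {a, b, c, d} and hence the components met by the switch. If ab and cd lie in the
-- same component G_i, the switch is a 2-switch of G_i and distinct such switches of G_i give
-- distinct graphs exactly when they do inside G_i. If ab lies in G_i and cd in G_j with i ≠ j,
-- then ac and bd are automatically non-edges, and the result is determined by the two edges
-- and by which of the reconnections {ac, bd} or {ad, bc} is chosen: 2‖G_i‖‖G_j‖ graphs.
-- Results coming from different components or pairs of components never coincide.

module Submission where

open import Defs
open import Data.Bool using (Bool; true; false; T; _∧_; _∨_; not; if_then_else_)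
open import Data.Bool.Properties using (T?; T-∧; T-≡; T-not-≡; ∧-zeroʳ; ∨-comm; ¬-not)
import Data.Bool.Properties as Bool
open import Data.Empty using (⊥; ⊥-elim)
open import Data.Fin using (Fin; toℕ; _≟_; _<_)
import Data.Fin.Properties as Fin
open import Data.Fin.Subset using (Subset)
open import Data.Nat using (ℕ; suc; _+_; _*_; _≤_; _<ᵇ_)
open import Data.Nat.ListAction using (sum)
import Data.Nat.Properties as ℕ
open import Data.Product using (_×_; _,_; ∃; proj₁; proj₂)
open import Data.Sum using (_⊎_; inj₁; inj₂; [_,_]′; assocˡ; assocʳ; map₂; swap)
open import Data.List using (List; []; _∷_; _++_; map; concat; concatMap; filter; length; deduplicate; [_]; cartesianProduct; allFin)
import Data.List.Properties as List
open import Data.List.Membership.Propositional using (_∈_; _∉_; lose; find)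
open import Data.List.Membership.Propositional.Properties using (deduplicate-∈⇔; ∈-map⁺; ∈-map⁻; ∈-concat⁻′; ∈-concatMap⁺; ∈-concatMap⁻; ∈-++⁺ˡ; ∈-++⁺ʳ; ∈-++⁻; ∈-filter⁺; ∈-filter⁻; ∈-cartesianProduct⁺; ∈-cartesianProduct⁻; ∈-allFin)
open import Data.List.Membership.Propositional.Properties.WithK using (unique∧set⇒bag)
import Data.List.Membership.DecPropositional as DecMembership
open import Data.List.Relation.Unary.Any using (here; there)
import Data.List.Relation.Unary.All as All
import Data.List.Relation.Unary.All.Properties as All
open import Data.List.Relation.Unary.All using ([]; _∷_)
open import Data.List.Relation.Unary.AllPairs using ([]; _∷_)
open import Data.List.Relation.Binary.BagAndSetEquality using (_∼[_]_; set; ∼bag⇒↭)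
open import Data.List.Relation.Binary.Disjoint.Propositional using (Disjoint)
open import Data.List.Relation.Binary.Permutation.Propositional.Properties using (↭-length)
open import Data.List.Relation.Binary.Permutation.Propositional.Properties.WithK using (dedup-++-↭)
open import Data.List.Relation.Unary.Unique.DecPropositional.Properties using (deduplicate-!)
open import Data.List.Relation.Unary.Unique.Propositional using (Unique)
import Data.List.Relation.Unary.Unique.Propositional.Properties as Unique
open import Data.Vec using (lookup; tabulate)
open import Data.Vec.Properties using (lookup∘tabulate; tabulate-cong; ≡-dec)
open import Data.Vec.Relation.Binary.Pointwise.Extensional using (ext; Pointwise-≡⇒≡)
open import Function.Base using (_∘_)
open import Function.Bundles using (_⇔_; mk⇔; Equivalence)
import Function.Properties.Equivalence as ⇔
open import Relation.Binary.Definitions using (DecidableEquality; tri<; tri≈; tri>)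
open import Relation.Binary.PropositionalEquality using (_≡_; _≢_; refl; sym; trans; cong; cong₂; subst; ≢-sym; module ≡-Reasoning)
open import Relation.Nullary using (Dec; yes; no; ¬_; contradiction)
open import Relation.Nullary.Decidable using (_⊎-dec_; toWitness; fromWitness; toWitnessFalse; fromWitnessFalse)

-- Counting in lists

module _ {a} {A : Set a} (_≟_ : DecidableEquality A) where

  open DecMembership _≟_ using (_∈?_)

  #distinct : List A → ℕ
  #distinct xs = length (deduplicate _≟_ xs)

  private
    uniqueSet⇒length : ∀ {xs ys : List A} → Unique xs → Unique ys → xs ∼[ set ] ys → length xs ≡ length ys
    uniqueSet⇒length xs! ys! xs∼ys = ↭-length (∼bag⇒↭ (unique∧set⇒bag xs! ys! xs∼ys))

  #distinct-cong : ∀ {xs ys : List A} → xs ∼[ set ] ys → #distinct xs ≡ #distinct ys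
  #distinct-cong {xs} {ys} xs∼ys = uniqueSet⇒length (deduplicate-! _≟_ xs) (deduplicate-! _≟_ ys)
    (λ {z} → ⇔.trans (⇔.sym (deduplicate-∈⇔ _≟_ {xs})) (⇔.trans (xs∼ys {z}) (deduplicate-∈⇔ _≟_ {ys})))

  #distinct-unique : ∀ {xs : List A} → Unique xs → #distinct xs ≡ length xs
  #distinct-unique {xs} xs! = uniqueSet⇒length (deduplicate-! _≟_ xs) xs! (⇔.sym (deduplicate-∈⇔ _≟_))

  #distinct-++ : ∀ {xs ys : List A} → Disjoint xs ys → #distinct (xs ++ ys) ≡ #distinct xs + #distinct ys
  #distinct-++ {xs} xs#ys = trans (↭-length (dedup-++-↭ _≟_ xs#ys)) (List.length-++ (deduplicate _≟_ xs))

  #distinct-∷-∈ : ∀ {x} {xs : List A} → x ∈ xs → #distinct (x ∷ xs) ≡ #distinct xs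
  #distinct-∷-∈ {x} {xs} x∈xs = #distinct-cong (mk⇔ to there)
    where
    to : ∀ {z} → z ∈ x ∷ xs → z ∈ xs
    to (here refl) = x∈xs
    to (there z∈xs) = z∈xs

  #distinct-∷-∉ : ∀ {x} {xs : List A} → x ∉ xs → #distinct (x ∷ xs) ≡ suc (#distinct xs)
  #distinct-∷-∉ {x} {xs} x∉xs = #distinct-++ {[ x ]} {xs} λ { (here refl , x∈xs) → x∉xs x∈xs }

  #distinct-concat : ∀ {b} {B : Set b} (F : B → List A) {is : List B} → Unique is →
    (∀ {i j} → i ∈ is → j ∈ is → i ≢ j → Disjoint (F i) (F j)) →
    #distinct (concat (map F is)) ≡ sum (map (λ i → #distinct (F i)) is)
  #distinct-concat F {[]} _ _ = refl
  #distinct-concat F {i ∷ is} (i∉is ∷ is!) disjoint =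
    trans (#distinct-++ Fi#rest) (cong (#distinct (F i) +_) (#distinct-concat F is! λ p q → disjoint (there p) (there q)))
    where
    Fi#rest : Disjoint (F i) (concat (map F is))
    Fi#rest (z∈Fi , z∈rest) with ∈-concat⁻′ (map F is) z∈rest
    ... | _ , z∈Fj , Fj∈ with ∈-map⁻ F Fj∈
    ... | j , j∈is , refl = disjoint (here refl) (there j∈is) (λ { refl → All.lookup i∉is j∈is refl }) (z∈Fi , z∈Fj)

  #distinct-map-kernel : ∀ {b} {B : Set b} (g h : B → A) (xs : List B) →
    (∀ {x y} → x ∈ xs → y ∈ xs → (g x ≡ g y) ⇔ (h x ≡ h y)) →
    #distinct (map g xs) ≡ #distinct (map h xs)
  #distinct-map-kernel g h [] _ = refl
  #distinct-map-kernel {B = B} g h (x ∷ xs) kernel = step (g x ∈? map g xs) (h x ∈? map h xs)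
    where
    IH : #distinct (map g xs) ≡ #distinct (map h xs)
    IH = #distinct-map-kernel g h xs λ p q → kernel (there p) (there q)

    image : (f f′ : B → A) → (∀ {y} → y ∈ xs → f x ≡ f y → f′ x ≡ f′ y) → f x ∈ map f xs → f′ x ∈ map f′ xs
    image f f′ same fx∈ with ∈-map⁻ f fx∈
    ... | y , y∈xs , fx≡fy = subst (_∈ map f′ xs) (sym (same y∈xs fx≡fy)) (∈-map⁺ f′ y∈xs)

    step : Dec (g x ∈ map g xs) → Dec (h x ∈ map h xs) → #distinct (g x ∷ map g xs) ≡ #distinct (h x ∷ map h xs)
    step (yes gx∈) (yes hx∈) = trans (#distinct-∷-∈ gx∈) (trans IH (sym (#distinct-∷-∈ hx∈)))
    step (no gx∉) (no hx∉) = trans (#distinct-∷-∉ gx∉) (trans (cong suc IH) (sym (#distinct-∷-∉ hx∉)))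
    step (yes gx∈) (no hx∉) = contradiction (image g h (λ y∈ → Equivalence.to (kernel (here refl) (there y∈))) gx∈) hx∉
    step (no gx∉) (yes hx∈) = contradiction (image h g (λ y∈ → Equivalence.from (kernel (here refl) (there y∈))) hx∈) gx∉

unique-map⁺ : ∀ {a b} {A : Set a} {B : Set b} (f : A → B) {xs : List A} →
  (∀ {x y} → x ∈ xs → y ∈ xs → f x ≡ f y → x ≡ y) → Unique xs → Unique (map f xs)
unique-map⁺ f {[]} _ [] = []
unique-map⁺ f {x ∷ xs} injective (x∉xs ∷ xs!) =
  All.map⁺ (All.tabulate λ y∈xs fx≡fy → All.lookup x∉xs y∈xs (injective (here refl) (there y∈xs) fx≡fy))
  ∷ unique-map⁺ f (λ p q → injective (there p) (there q)) xs!

length-cartesianProduct : ∀ {a b} {A : Set a} {B : Set b} (xs : List A) (ys : List B) →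
  length (cartesianProduct xs ys) ≡ length xs * length ys
length-cartesianProduct [] ys = refl
length-cartesianProduct (x ∷ xs) ys = trans (List.length-++ (map (x ,_) ys))
  (cong₂ _+_ (List.length-map (x ,_) ys) (length-cartesianProduct xs ys))

_∈₂_ : ∀ {a} {A : Set a} → A → A × A → Set a
x ∈₂ (y , z) = x ≡ y ⊎ x ≡ z

sorted-⊆₂⇒≡ : ∀ {m} {u v u′ v′ : Fin m} → u < v → u′ < v′ → u ∈₂ (u′ , v′) → v ∈₂ (u′ , v′) → (u , v) ≡ (u′ , v′)
sorted-⊆₂⇒≡ u<v _ (inj₁ refl) (inj₁ refl) = ⊥-elim (Fin.<-irrefl refl u<v)
sorted-⊆₂⇒≡ _ _ (inj₁ refl) (inj₂ refl) = refl
sorted-⊆₂⇒≡ u<v u′<v′ (inj₂ refl) (inj₁ refl) = ⊥-elim (Fin.<-asym u<v u′<v′)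
sorted-⊆₂⇒≡ u<v _ (inj₂ refl) (inj₂ refl) = ⊥-elim (Fin.<-irrefl refl u<v)

-- 2-switches of an adjacency matrix

T-∧⁻ : ∀ x {y} → T (x ∧ y) → T x × T y
T-∧⁻ _ = Equivalence.to T-∧

Quad : ℕ → Set
Quad n = Fin n × Fin n × Fin n × Fin n

module _ {n : ℕ} where

  ==-refl : (u : Fin n) → (u == u) ≡ true
  ==-refl u = Equivalence.to T-≡ (fromWitness refl)

  ==-false : {u v : Fin n} → u ≢ v → (u == v) ≡ false
  ==-false u≢v = Equivalence.to T-not-≡ (fromWitnessFalse u≢v)

  samePair-refl : (u v : Fin n) → samePair u v u v ≡ true
  samePair-refl u v rewrite ==-refl u | ==-refl v = refl

  samePair-comm : (u v x y : Fin n) → samePair u v x y ≡ samePair u v y x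
  samePair-comm u v x y = ∨-comm ((u == x) ∧ (v == y)) ((u == y) ∧ (v == x))

  samePair-≢ˡ : ∀ {u} v {x y : Fin n} → u ≢ x → u ≢ y → samePair u v x y ≡ false
  samePair-≢ˡ v u≢x u≢y rewrite ==-false u≢x | ==-false u≢y = refl

  samePair-≢ʳ : ∀ u {v x y : Fin n} → v ≢ x → v ≢ y → samePair u v x y ≡ false
  samePair-≢ʳ u {x = x} {y} v≢x v≢y
    rewrite ==-false v≢x | ==-false v≢y | ∧-zeroʳ (u == x) | ∧-zeroʳ (u == y) = refl

  Adj-ext : {X Y : Adj n} → (∀ u v → adj X u v ≡ adj Y u v) → X ≡ Y
  Adj-ext X≗Y = Pointwise-≡⇒≡ (ext λ u → Pointwise-≡⇒≡ (ext (X≗Y u)))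

  adj-switch : ∀ (X : Adj n) a b c d u v → adj (switch X a b c d) u v ≡
    (if samePair u v a c ∨ samePair u v b d then true
     else if samePair u v a b ∨ samePair u v c d then false
     else adj X u v)
  adj-switch X a b c d u v = trans (cong (λ row → lookup row v) (lookup∘tabulate _ u)) (lookup∘tabulate _ v)

  switch-swap-ends : ∀ (X : Adj n) a b c d → switch X a b c d ≡ switch X b a d c
  switch-swap-ends X a b c d = tabulate-cong λ u → tabulate-cong λ v →
    cong₂ (λ add remove → if add then true else if remove then false else adj X u v)
      (∨-comm (samePair u v a c) (samePair u v b d))
      (cong₂ _∨_ (samePair-comm u v a b) (samePair-comm u v c d))

  switch-swap-edges : ∀ (X : Adj n) a b c d → switch X a b c d ≡ switch X c d a b
  switch-swap-edges X a b c d = tabulate-cong λ u → tabulate-cong λ v →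
    cong₂ (λ add remove → if add then true else if remove then false else adj X u v)
      (cong₂ _∨_ (samePair-comm u v a c) (samePair-comm u v b d))
      (∨-comm (samePair u v a b) (samePair u v c d))

  Touches : Quad n → Fin n → Set
  Touches (a , b , c , d) u = u ≡ a ⊎ u ≡ b ⊎ u ≡ c ⊎ u ≡ d

  touches? : ∀ q u → Dec (Touches q u)
  touches? (a , b , c , d) u = u ≟ a ⊎-dec u ≟ b ⊎-dec u ≟ c ⊎-dec u ≟ d

  private
    ≢-touched : ∀ {a b c d w} → ¬ Touches (a , b , c , d) w → w ≢ a × w ≢ b × w ≢ c × w ≢ d
    ≢-touched w∉q = w∉q ∘ inj₁ , w∉q ∘ inj₂ ∘ inj₁ , w∉q ∘ inj₂ ∘ inj₂ ∘ inj₁ , w∉q ∘ inj₂ ∘ inj₂ ∘ inj₂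

    adj-switch-avoiding : ∀ (X : Adj n) a b c d {u v w} →
      (∀ {x y} → w ≢ x → w ≢ y → samePair u v x y ≡ false) →
      w ≢ a × w ≢ b × w ≢ c × w ≢ d → adj (switch X a b c d) u v ≡ adj X u v
    adj-switch-avoiding X a b c d {u} {v} avoid (≢a , ≢b , ≢c , ≢d)
      rewrite adj-switch X a b c d u v | avoid ≢a ≢c | avoid ≢b ≢d | avoid ≢a ≢b | avoid ≢c ≢d = refl

  adj-switch-untouched : ∀ (X : Adj n) q {u v} → ¬ Touches q u ⊎ ¬ Touches q v → adj (switchQ X q) u v ≡ adj X u v
  adj-switch-untouched X (a , b , c , d) {u} {v} (inj₁ u∉q) = adj-switch-avoiding X a b c d (samePair-≢ˡ v) (≢-touched u∉q)
  adj-switch-untouched X (a , b , c , d) {u} {v} (inj₂ v∉q) = adj-switch-avoiding X a b c d (samePair-≢ʳ u) (≢-touched v∉q)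

  adj-switch-touched : ∀ (X : Adj n) q {u v} → adj (switchQ X q) u v ≢ adj X u v → Touches q u × Touches q v
  adj-switch-touched X q {u} {v} changed with touches? q u | touches? q v
  ... | yes u∈q | yes v∈q = u∈q , v∈q
  ... | no u∉q | _ = contradiction (adj-switch-untouched X q (inj₁ u∉q)) changed
  ... | _ | no v∉q = contradiction (adj-switch-untouched X q (inj₂ v∉q)) changed

  record TwoSwitch (X : Adj n) (a b c d : Fin n) : Set where
    field
      a≢b : a ≢ b
      a≢c : a ≢ c
      a≢d : a ≢ d
      b≢c : b ≢ c
      b≢d : b ≢ d
      c≢d : c ≢ d
      ab∈X : adj X a b ≡ true
      cd∈X : adj X c d ≡ true
      ac∉X : adj X a c ≡ false
      bd∉X : adj X b d ≡ false

  IsTwoSwitch : Adj n → Quad n → Set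
  IsTwoSwitch X (a , b , c , d) = TwoSwitch X a b c d

  module _ {X : Adj n} {a b c d : Fin n} (σ : TwoSwitch X a b c d) where
    open TwoSwitch σ

    adj-switch-ab : adj (switch X a b c d) a b ≡ false
    adj-switch-ab rewrite adj-switch X a b c d a b
      | samePair-≢ʳ a (≢-sym a≢b) b≢c | samePair-≢ˡ b a≢b a≢d | samePair-refl a b = refl

    adj-switch-cd : adj (switch X a b c d) c d ≡ false
    adj-switch-cd rewrite adj-switch X a b c d c d
      | samePair-≢ʳ c (≢-sym a≢d) (≢-sym c≢d) | samePair-≢ˡ d (≢-sym b≢c) c≢d
      | samePair-≢ˡ d (≢-sym a≢c) (≢-sym b≢c) | samePair-refl c d = refl

    adj-switch-ad : adj (switch X a b c d) a d ≡ adj X a d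
    adj-switch-ad rewrite adj-switch X a b c d a d
      | samePair-≢ʳ a (≢-sym a≢d) (≢-sym c≢d) | samePair-≢ˡ d a≢b a≢d
      | samePair-≢ʳ a (≢-sym a≢d) (≢-sym b≢d) | samePair-≢ˡ d a≢c a≢d = refl

  adj-switch-ac : ∀ (X : Adj n) a b c d → adj (switch X a b c d) a c ≡ true
  adj-switch-ac X a b c d rewrite adj-switch X a b c d a c | samePair-refl a c = refl

  InSubset : Subset n → Quad n → Set
  InSubset S (a , b , c , d) = T (inS S a) × T (inS S b) × T (inS S c) × T (inS S d)

  isSwitch⁻ : ∀ {S X a b c d} → T (isSwitch S X a b c d) → InSubset S (a , b , c , d) × TwoSwitch X a b c d
  isSwitch⁻ {S} {X} {a} {b} {c} {d} t =
    let sa , t = T-∧⁻ (inS S a) t ; sb , t = T-∧⁻ (inS S b) t ; sc , t = T-∧⁻ (inS S c) t ; sd , t = T-∧⁻ (inS S d) t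
        a≢b , t = T-∧⁻ (not (a == b)) t ; a≢c , t = T-∧⁻ (not (a == c)) t ; a≢d , t = T-∧⁻ (not (a == d)) t
        b≢c , t = T-∧⁻ (not (b == c)) t ; b≢d , t = T-∧⁻ (not (b == d)) t ; c≢d , t = T-∧⁻ (not (c == d)) t
        ab∈X , t = T-∧⁻ (adj X a b) t ; cd∈X , t = T-∧⁻ (adj X c d) t ; ac∉X , bd∉X = T-∧⁻ (not (adj X a c)) t
    in (sa , sb , sc , sd) , record
      { a≢b = toWitnessFalse a≢b ; a≢c = toWitnessFalse a≢c ; a≢d = toWitnessFalse a≢d
      ; b≢c = toWitnessFalse b≢c ; b≢d = toWitnessFalse b≢d ; c≢d = toWitnessFalse c≢d
      ; ab∈X = Equivalence.to T-≡ ab∈X ; cd∈X = Equivalence.to T-≡ cd∈X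
      ; ac∉X = Equivalence.to T-not-≡ ac∉X ; bd∉X = Equivalence.to T-not-≡ bd∉X }

  isSwitch⁺ : ∀ {S X a b c d} → InSubset S (a , b , c , d) → TwoSwitch X a b c d → T (isSwitch S X a b c d)
  isSwitch⁺ {S} {X} {a} {b} {c} {d} (sa , sb , sc , sd) σ = Equivalence.from T-≡ isSwitch≡true
    where
    open TwoSwitch σ
    isSwitch≡true : isSwitch S X a b c d ≡ true
    isSwitch≡true rewrite Equivalence.to T-≡ sa | Equivalence.to T-≡ sb | Equivalence.to T-≡ sc | Equivalence.to T-≡ sd
      | ==-false a≢b | ==-false a≢c | ==-false a≢d | ==-false b≢c | ==-false b≢d | ==-false c≢d
      | ab∈X | cd∈X | ac∉X | bd∉X = refl

  validQuads : Subset n → Adj n → List (Quad n)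
  validQuads S X = filter (λ q → T? (isSwitchQ S X q)) (quadruples n)

  ∈-validQuads⁻ : ∀ {S X} q → q ∈ validQuads S X → InSubset S q × IsTwoSwitch X q
  ∈-validQuads⁻ {S} {X} _ q∈ = isSwitch⁻ {S} {X} (proj₂ (∈-filter⁻ (λ q → T? (isSwitchQ S X q)) {xs = quadruples n} q∈))

  ∈-validQuads⁺ : ∀ {S X} q → InSubset S q → IsTwoSwitch X q → q ∈ validQuads S X
  ∈-validQuads⁺ {S} {X} (a , b , c , d) q⊆S σ = ∈-filter⁺ (λ q → T? (isSwitchQ S X q))
    (∈-cartesianProduct⁺ (∈-allFin a) (∈-cartesianProduct⁺ (∈-allFin b) (∈-cartesianProduct⁺ (∈-allFin c) (∈-allFin d))))
    (isSwitch⁺ {S} {X} q⊆S σ)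

  TwoSwitch-transfer : ∀ {X Y : Adj n} q → (∀ {u v} → Touches q u → Touches q v → adj X u v ≡ adj Y u v) →
    IsTwoSwitch X q → IsTwoSwitch Y q
  TwoSwitch-transfer (a , b , c , d) X≈Y σ = record
    { a≢b = a≢b ; a≢c = a≢c ; a≢d = a≢d ; b≢c = b≢c ; b≢d = b≢d ; c≢d = c≢d
    ; ab∈X = trans (sym (X≈Y ∈a ∈b)) ab∈X ; cd∈X = trans (sym (X≈Y ∈c ∈d)) cd∈X
    ; ac∉X = trans (sym (X≈Y ∈a ∈c)) ac∉X ; bd∉X = trans (sym (X≈Y ∈b ∈d)) bd∉X }
    where
    open TwoSwitch σ
    ∈a : Touches (a , b , c , d) a
    ∈a = inj₁ refl
    ∈b : Touches (a , b , c , d) b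
    ∈b = inj₂ (inj₁ refl)
    ∈c : Touches (a , b , c , d) c
    ∈c = inj₂ (inj₂ (inj₁ refl))
    ∈d : Touches (a , b , c , d) d
    ∈d = inj₂ (inj₂ (inj₂ refl))

  adj-switch-cong : ∀ {X Y : Adj n} q {u v} → adj X u v ≡ adj Y u v → adj (switchQ X q) u v ≡ adj (switchQ Y q) u v
  adj-switch-cong {X} {Y} (a , b , c , d) {u} {v} X≈Y
    rewrite adj-switch X a b c d u v | adj-switch Y a b c d u v | X≈Y = refl

  switch-≡-transfer : ∀ {P : Fin n → Set} → (∀ u → Dec (P u)) → {X Y : Adj n} →
    (∀ {u v} → P u → P v → adj X u v ≡ adj Y u v) → ∀ {q q′} →
    (∀ {u} → Touches q u → P u) → (∀ {u} → Touches q′ u → P u) →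
    switchQ X q ≡ switchQ X q′ → switchQ Y q ≡ switchQ Y q′
  switch-≡-transfer P? {X} {Y} X≈Y {q} {q′} q⊆P q′⊆P Xq≡Xq′ = Adj-ext entry
    where
    entry : ∀ u v → adj (switchQ Y q) u v ≡ adj (switchQ Y q′) u v
    entry u v with P? u | P? v
    ... | yes Pu | yes Pv = begin
      adj (switchQ Y q) u v   ≡⟨ adj-switch-cong {X} {Y} q (X≈Y Pu Pv) ⟨
      adj (switchQ X q) u v   ≡⟨ cong (λ Z → adj Z u v) Xq≡Xq′ ⟩
      adj (switchQ X q′) u v  ≡⟨ adj-switch-cong {X} {Y} q′ (X≈Y Pu Pv) ⟩
      adj (switchQ Y q′) u v  ∎
      where open ≡-Reasoning
    ... | no ¬Pu | _ = trans (adj-switch-untouched Y q (inj₁ (¬Pu ∘ q⊆P))) (sym (adj-switch-untouched Y q′ (inj₁ (¬Pu ∘ q′⊆P))))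
    ... | _ | no ¬Pv = trans (adj-switch-untouched Y q (inj₂ (¬Pv ∘ q⊆P))) (sym (adj-switch-untouched Y q′ (inj₂ (¬Pv ∘ q′⊆P))))

  switch-≡⇒touches-⊆ : ∀ {X : Adj n} q q′ → IsTwoSwitch X q → switchQ X q ≡ switchQ X q′ →
    ∀ {u} → Touches q u → Touches q′ u
  switch-≡⇒touches-⊆ {X} (a , b , c , d) q′ σ q≡q′ = λ
    { (inj₁ refl) → proj₁ ab ; (inj₂ (inj₁ refl)) → proj₂ ab
    ; (inj₂ (inj₂ (inj₁ refl))) → proj₁ cd ; (inj₂ (inj₂ (inj₂ refl))) → proj₂ cd }
    where
    open TwoSwitch σ
    removed : ∀ {u v} → adj (switch X a b c d) u v ≡ false → adj X u v ≡ true → adj (switchQ X q′) u v ≢ adj X u v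
    removed {u} {v} gone present same =
      contradiction (trans (sym gone) (trans (cong (λ Z → adj Z u v) q≡q′) (trans same present))) λ ()
    ab : Touches q′ a × Touches q′ b
    ab = adj-switch-touched X q′ (removed (adj-switch-ab σ) ab∈X)
    cd : Touches q′ c × Touches q′ d
    cd = adj-switch-touched X q′ (removed (adj-switch-cd σ) cd∈X)

  switch-≡⇒touches-added : ∀ {X : Adj n} q {a b c d} → adj X a c ≡ false → switchQ X q ≡ switch X a b c d →
    Touches q a × Touches q c
  switch-≡⇒touches-added {X} q {a} {b} {c} {d} ac∉X q≡q′ = adj-switch-touched X q λ same →
    contradiction (trans (sym (adj-switch-ac X a b c d)) (trans (cong (λ Z → adj Z a c) (sym q≡q′)) (trans same ac∉X))) λ ()

-- The 2-switches of a graph with labelled components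

_≟ᴬ_ : ∀ {n} → DecidableEquality (Adj n)
_≟ᴬ_ = ≡-dec (≡-dec Bool._≟_)

module Components {n k : ℕ} (M : Adj n) (M-sym : ∀ u v → adj M u v ≡ adj M v u)
  (comp : Fin n → Fin k) (comp-adj : ∀ u v → adj M u v ≡ true → comp u ≡ comp v) where

  V : Fin k → Subset n
  V = compVerts comp

  G : Fin k → Adj n
  G = compAdj M comp

  inS-V : ∀ {i u} → T (inS (V i) u) ⇔ comp u ≡ i
  inS-V {i} {u} = subst (λ b → T b ⇔ comp u ≡ i) (sym (lookup∘tabulate _ u))
    (mk⇔ (toWitness {a? = comp u ≟ i}) fromWitness)

  adj-G : ∀ {i u v} → comp u ≡ i → comp v ≡ i → adj (G i) u v ≡ adj M u v
  adj-G {i} {u} {v} comp-u comp-v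
    rewrite lookup∘tabulate (λ u → tabulate λ v → (comp u == i) ∧ (comp v == i) ∧ adj M u v) u
          | lookup∘tabulate (λ v → (comp u == i) ∧ (comp v == i) ∧ adj M u v) v
          | comp-u | comp-v | ==-refl i = refl

  adj-across : ∀ {u v} → comp u ≢ comp v → adj M u v ≡ false
  adj-across ≢comp = ¬-not (≢comp ∘ comp-adj _ _)

  InComponent : Fin k → Quad n → Set
  InComponent i (a , b , c , d) = comp a ≡ i × comp b ≡ i × comp c ≡ i × comp d ≡ i

  touches-InComponent : ∀ {i} q → InComponent i q → ∀ {u} → Touches q u → comp u ≡ i
  touches-InComponent _ (ca , _ , _ , _) (inj₁ refl) = ca
  touches-InComponent _ (_ , cb , _ , _) (inj₂ (inj₁ refl)) = cb
  touches-InComponent _ (_ , _ , cc , _) (inj₂ (inj₂ (inj₁ refl))) = cc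
  touches-InComponent _ (_ , _ , _ , cd) (inj₂ (inj₂ (inj₂ refl))) = cd

  G≈M : ∀ {i} q → InComponent i q → ∀ {u v} → Touches q u → Touches q v → adj (G i) u v ≡ adj M u v
  G≈M q q⊆i u∈q v∈q = adj-G (touches-InComponent q q⊆i u∈q) (touches-InComponent q q⊆i v∈q)

  ∈-componentQuads⁻ : ∀ {i} q → q ∈ validQuads (V i) (G i) → InComponent i q × IsTwoSwitch M q
  ∈-componentQuads⁻ {i} q q∈ =
    let (sa , sb , sc , sd) , σ = ∈-validQuads⁻ {S = V i} {X = G i} q q∈
        q⊆i = Equivalence.to inS-V sa , Equivalence.to inS-V sb , Equivalence.to inS-V sc , Equivalence.to inS-V sd
    in q⊆i , TwoSwitch-transfer q (G≈M q q⊆i) σ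

  ∈-componentQuads⁺ : ∀ {i} q → InComponent i q → IsTwoSwitch M q → q ∈ validQuads (V i) (G i)
  ∈-componentQuads⁺ {i} q q⊆i@(ca , cb , cc , cd) σ = ∈-validQuads⁺ {S = V i} {X = G i} q
    (Equivalence.from inS-V ca , Equivalence.from inS-V cb , Equivalence.from inS-V cc , Equivalence.from inS-V cd)
    (TwoSwitch-transfer q (λ u∈q v∈q → sym (G≈M q q⊆i u∈q v∈q)) σ)

  innerResults : Fin k → List (Adj n)
  innerResults i = map (switchQ M) (validQuads (V i) (G i))

  #innerResults : ∀ i → #distinct _≟ᴬ_ (innerResults i) ≡ deg (V i) (G i)
  #innerResults i = #distinct-map-kernel _≟ᴬ_ (switchQ M) (switchQ (G i)) (validQuads (V i) (G i))
    λ {q} {q′} q∈ q′∈ → let q⊆i = proj₁ (∈-componentQuads⁻ q q∈) ; q′⊆i = proj₁ (∈-componentQuads⁻ q′ q′∈) in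
      mk⇔ (switch-≡-transfer (λ u → comp u ≟ i) {M} {G i} (λ cu cv → sym (adj-G cu cv))
             (touches-InComponent q q⊆i) (touches-InComponent q′ q′⊆i))
          (switch-≡-transfer (λ u → comp u ≟ i) {G i} {M} adj-G
             (touches-InComponent q q⊆i) (touches-InComponent q′ q′⊆i))

  ∈-innerResults⁻ : ∀ {i z} → z ∈ innerResults i → ∃ λ q → (InComponent i q × IsTwoSwitch M q) × z ≡ switchQ M q
  ∈-innerResults⁻ z∈ with ∈-map⁻ (switchQ M) z∈
  ... | q , q∈ , z≡ = q , ∈-componentQuads⁻ q q∈ , z≡

  EdgeOf : Fin k → Fin n → Fin n → Set
  EdgeOf i u v = u ≢ v × comp u ≡ i × comp v ≡ i × adj M u v ≡ true

  EdgeOf-sym : ∀ {i u v} → EdgeOf i u v → EdgeOf i v u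
  EdgeOf-sym {u = u} {v} (u≢v , cu , cv , uv∈M) = ≢-sym u≢v , cv , cu , trans (M-sym v u) uv∈M

  isEdge : Fin k → Fin n × Fin n → Bool
  isEdge i (u , v) = (toℕ u <ᵇ toℕ v) ∧ inS (V i) u ∧ inS (V i) v ∧ adj (G i) u v

  edges : Fin k → List (Fin n × Fin n)
  edges i = filter (λ e → T? (isEdge i e)) (cartesianProduct (allFin n) (allFin n))

  ∈-edges⁻ : ∀ {i u v} → (u , v) ∈ edges i → u < v × EdgeOf i u v
  ∈-edges⁻ {i} {u} {v} uv∈ =
    let u<ᵇv , t = T-∧⁻ (toℕ u <ᵇ toℕ v) (proj₂ (∈-filter⁻ (λ e → T? (isEdge i e)) {xs = cartesianProduct (allFin n) (allFin n)} uv∈))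
        su , t = T-∧⁻ (inS (V i) u) t ; sv , uv∈G = T-∧⁻ (inS (V i) v) t
        cu = Equivalence.to inS-V su ; cv = Equivalence.to inS-V sv
        u<v = ℕ.<ᵇ⇒< (toℕ u) (toℕ v) u<ᵇv
    in u<v , Fin.<⇒≢ u<v , cu , cv , trans (sym (adj-G cu cv)) (Equivalence.to T-≡ uv∈G)

  ∈-edges⁺ : ∀ {i u v} → u < v → EdgeOf i u v → (u , v) ∈ edges i
  ∈-edges⁺ {i} {u} {v} u<v (_ , cu , cv , uv∈M) = ∈-filter⁺ (λ e → T? (isEdge i e))
    (∈-cartesianProduct⁺ (∈-allFin u) (∈-allFin v)) (Equivalence.from T-≡ isEdge≡true)
    where
    isEdge≡true : isEdge i (u , v) ≡ true
    isEdge≡true rewrite Equivalence.to T-≡ (ℕ.<⇒<ᵇ u<v) | Equivalence.to T-≡ (Equivalence.from (inS-V {i}) cu)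
      | Equivalence.to T-≡ (Equivalence.from (inS-V {i}) cv) | adj-G cu cv | uv∈M = refl

  ∈-edges-oriented : ∀ {i u v} → EdgeOf i u v → (u , v) ∈ edges i ⊎ (v , u) ∈ edges i
  ∈-edges-oriented {u = u} {v} uv with Fin.<-cmp u v
  ... | tri< u<v _ _ = inj₁ (∈-edges⁺ u<v uv)
  ... | tri≈ _ u≡v _ = contradiction u≡v (proj₁ uv)
  ... | tri> _ _ v<u = inj₂ (∈-edges⁺ v<u (EdgeOf-sym uv))

  twoSwitch-across : ∀ {i j a b c d} → i ≢ j → EdgeOf i a b → EdgeOf j c d → TwoSwitch M a b c d
  twoSwitch-across {i} {j} i≢j (a≢b , ca , cb , ab∈M) (c≢d , cc , cd , cd∈M) = record
    { a≢b = a≢b ; a≢c = separated ca cc ∘ cong comp ; a≢d = separated ca cd ∘ cong comp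
    ; b≢c = separated cb cc ∘ cong comp ; b≢d = separated cb cd ∘ cong comp ; c≢d = c≢d
    ; ab∈X = ab∈M ; cd∈X = cd∈M ; ac∉X = adj-across (separated ca cc) ; bd∉X = adj-across (separated cb cd) }
    where
    separated : ∀ {u v} → comp u ≡ i → comp v ≡ j → comp u ≢ comp v
    separated cu cv cu≡cv = i≢j (trans (sym cu) (trans cu≡cv cv))

  -- The two ways of reconnecting the edges uv and xy: adding ux, vy or uy, vx.
  crossQuad : Fin n × Fin n → Fin n × Fin n → Bool → Quad n
  crossQuad (u , v) (x , y) true = u , v , x , y
  crossQuad (u , v) (x , y) false = u , v , y , x

  touches-crossQuad : ∀ e f β {w} → Touches (crossQuad e f β) w ⇔ (w ∈₂ e ⊎ w ∈₂ f)
  touches-crossQuad (u , v) (x , y) true = mk⇔ assocˡ assocʳ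
  touches-crossQuad (u , v) (x , y) false = mk⇔ (map₂ swap ∘ assocˡ) (assocʳ ∘ map₂ swap)

  Choice : Set
  Choice = (Fin n × Fin n) × (Fin n × Fin n) × Bool

  crossSwitch : Choice → Adj n
  crossSwitch (e , f , β) = switchQ M (crossQuad e f β)

  choices : Fin k → Fin k → List Choice
  choices i j = cartesianProduct (edges i) (cartesianProduct (edges j) (true ∷ false ∷ []))

  crossResults : Fin k × Fin k → List (Adj n)
  crossResults (i , j) = map crossSwitch (choices i j)

  ∈-choices⁻ : ∀ {i j e f β} → (e , f , β) ∈ choices i j → e ∈ edges i × f ∈ edges j
  ∈-choices⁻ {i} {j} t∈ with ∈-cartesianProduct⁻ (edges i) _ t∈
  ... | e∈ , fβ∈ = e∈ , proj₁ (∈-cartesianProduct⁻ (edges j) _ fβ∈)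

  ∈-choices⁺ : ∀ {i j e f} β → e ∈ edges i → f ∈ edges j → (e , f , β) ∈ choices i j
  ∈-choices⁺ β e∈ f∈ = ∈-cartesianProduct⁺ e∈ (∈-cartesianProduct⁺ f∈ (β∈ β))
    where
    β∈ : ∀ β → β ∈ true ∷ false ∷ []
    β∈ true = here refl
    β∈ false = there (here refl)

  Straddles : Fin k → Fin k → Quad n → Set
  Straddles i j (a , b , c , d) = (comp a ≡ i × comp b ≡ i) × (comp c ≡ j × comp d ≡ j)

  touches-Straddles : ∀ {i j} q → Straddles i j q → ∀ {u} → Touches q u → comp u ∈₂ (i , j)
  touches-Straddles _ ((ca , _) , _) (inj₁ refl) = inj₁ ca
  touches-Straddles _ ((_ , cb) , _) (inj₂ (inj₁ refl)) = inj₁ cb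
  touches-Straddles _ (_ , (cc , _)) (inj₂ (inj₂ (inj₁ refl))) = inj₂ cc
  touches-Straddles _ (_ , (_ , cd)) (inj₂ (inj₂ (inj₂ refl))) = inj₂ cd

  crossQuad-valid : ∀ {i j e f} β → i ≢ j → e ∈ edges i → f ∈ edges j →
    IsTwoSwitch M (crossQuad e f β) × Straddles i j (crossQuad e f β)
  crossQuad-valid true i≢j e∈ f∈ with ∈-edges⁻ e∈ | ∈-edges⁻ f∈
  ... | _ , uv@(_ , cu , cv , _) | _ , xy@(_ , cx , cy , _) = twoSwitch-across i≢j uv xy , (cu , cv) , (cx , cy)
  crossQuad-valid false i≢j e∈ f∈ with ∈-edges⁻ e∈ | ∈-edges⁻ f∈
  ... | _ , uv@(_ , cu , cv , _) | _ , xy@(_ , cx , cy , _) = twoSwitch-across i≢j uv (EdgeOf-sym xy) , (cu , cv) , (cy , cx)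

  ∈-crossResults⁻ : ∀ {i j z} → i ≢ j → z ∈ crossResults (i , j) →
    ∃ λ q → (IsTwoSwitch M q × Straddles i j q) × z ≡ switchQ M q
  ∈-crossResults⁻ i≢j z∈ with ∈-map⁻ crossSwitch z∈
  ... | (e , f , β) , t∈ , z≡ with ∈-choices⁻ t∈
  ...   | e∈ , f∈ = crossQuad e f β , crossQuad-valid β i≢j e∈ f∈ , z≡

  ∈-crossResults⁺ : ∀ {i j a b c d} → EdgeOf i a b → EdgeOf j c d → switch M a b c d ∈ crossResults (i , j)
  ∈-crossResults⁺ {a = a} {b} {c} {d} ab cd with ∈-edges-oriented ab | ∈-edges-oriented cd
  ... | inj₁ ab∈ | inj₁ cd∈ = ∈-map⁺ crossSwitch (∈-choices⁺ true ab∈ cd∈)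
  ... | inj₁ ab∈ | inj₂ dc∈ = ∈-map⁺ crossSwitch (∈-choices⁺ false ab∈ dc∈)
  ... | inj₂ ba∈ | inj₁ cd∈ = subst (_∈ _) (sym (switch-swap-ends M a b c d)) (∈-map⁺ crossSwitch (∈-choices⁺ false ba∈ cd∈))
  ... | inj₂ ba∈ | inj₂ dc∈ = subst (_∈ _) (sym (switch-swap-ends M a b c d)) (∈-map⁺ crossSwitch (∈-choices⁺ true ba∈ dc∈))

  ∈₂-edges : ∀ {i e w} → e ∈ edges i → w ∈₂ e → comp w ≡ i
  ∈₂-edges {e = u , v} e∈ (inj₁ refl) = proj₁ (proj₂ (proj₂ (∈-edges⁻ e∈)))
  ∈₂-edges {e = u , v} e∈ (inj₂ refl) = proj₁ (proj₂ (proj₂ (proj₂ (∈-edges⁻ e∈))))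

  edges-⊆₂⇒≡ : ∀ {i e e′} → e ∈ edges i → e′ ∈ edges i → (∀ {w} → w ∈₂ e → w ∈₂ e′) → e ≡ e′
  edges-⊆₂⇒≡ {e = u , v} e∈ e′∈ e⊆e′ =
    sorted-⊆₂⇒≡ (proj₁ (∈-edges⁻ e∈)) (proj₁ (∈-edges⁻ e′∈)) (e⊆e′ (inj₁ refl)) (e⊆e′ (inj₂ refl))

  crossSwitch-≡⇒edges-⊆ : ∀ {i j e f β e′ f′ β′} → i ≢ j → e ∈ edges i → f ∈ edges j → e′ ∈ edges i → f′ ∈ edges j →
    crossSwitch (e , f , β) ≡ crossSwitch (e′ , f′ , β′) →
    (∀ {w} → w ∈₂ e → w ∈₂ e′) × (∀ {w} → w ∈₂ f → w ∈₂ f′)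
  crossSwitch-≡⇒edges-⊆ {i} {j} {e} {f} {β} {e′} {f′} {β′} i≢j e∈ f∈ e′∈ f′∈ eq = e⊆e′ , f⊆f′
    where
    covered : ∀ {w} → w ∈₂ e ⊎ w ∈₂ f → w ∈₂ e′ ⊎ w ∈₂ f′
    covered = Equivalence.to (touches-crossQuad e′ f′ β′)
      ∘ switch-≡⇒touches-⊆ (crossQuad e f β) (crossQuad e′ f′ β′) (proj₁ (crossQuad-valid β i≢j e∈ f∈)) eq
      ∘ Equivalence.from (touches-crossQuad e f β)

    e⊆e′ : ∀ {w} → w ∈₂ e → w ∈₂ e′
    e⊆e′ w∈e with covered (inj₁ w∈e)
    ... | inj₁ w∈e′ = w∈e′
    ... | inj₂ w∈f′ = contradiction (trans (sym (∈₂-edges e∈ w∈e)) (∈₂-edges f′∈ w∈f′)) i≢j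

    f⊆f′ : ∀ {w} → w ∈₂ f → w ∈₂ f′
    f⊆f′ w∈f with covered (inj₂ w∈f)
    ... | inj₁ w∈e′ = contradiction (trans (sym (∈₂-edges e′∈ w∈e′)) (∈₂-edges f∈ w∈f)) i≢j
    ... | inj₂ w∈f′ = w∈f′

  crossSwitch-flag : ∀ {i j e f} → i ≢ j → e ∈ edges i → f ∈ edges j → crossSwitch (e , f , true) ≢ crossSwitch (e , f , false)
  crossSwitch-flag {e = u , v} {x , y} i≢j e∈ f∈ eq = contradiction entry-ux λ ()
    where
    open ≡-Reasoning
    entry-ux : true ≡ false
    entry-ux = begin
      true                        ≡⟨ adj-switch-ac M u v x y ⟨
      adj (switch M u v x y) u x  ≡⟨ cong (λ Z → adj Z u x) eq ⟩
      adj (switch M u v y x) u x  ≡⟨ adj-switch-ad (proj₁ (crossQuad-valid false i≢j e∈ f∈)) ⟩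
      adj M u x                   ≡⟨ adj-across (λ cu≡cx → i≢j (trans (sym (∈₂-edges e∈ (inj₁ refl))) (trans cu≡cx (∈₂-edges f∈ (inj₁ refl))))) ⟩
      false                       ∎

  crossSwitch-injective : ∀ {i j} → i ≢ j → ∀ {t t′} → t ∈ choices i j → t′ ∈ choices i j →
    crossSwitch t ≡ crossSwitch t′ → t ≡ t′
  crossSwitch-injective i≢j {e , f , β} {e′ , f′ , β′} t∈ t′∈ eq
    with ∈-choices⁻ t∈ | ∈-choices⁻ t′∈
  ... | e∈ , f∈ | e′∈ , f′∈
    with crossSwitch-≡⇒edges-⊆ {β = β} {β′ = β′} i≢j e∈ f∈ e′∈ f′∈ eq
  ... | e⊆e′ , f⊆f′
    with edges-⊆₂⇒≡ e∈ e′∈ e⊆e′ | edges-⊆₂⇒≡ f∈ f′∈ f⊆f′ | β | β′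
  ... | refl | refl | true | true = refl
  ... | refl | refl | false | false = refl
  ... | refl | refl | true | false = contradiction eq (crossSwitch-flag i≢j e∈ f∈)
  ... | refl | refl | false | true = contradiction (sym eq) (crossSwitch-flag i≢j e∈ f∈)

  edges-unique : ∀ i → Unique (edges i)
  edges-unique i = Unique.filter⁺ (λ e → T? (isEdge i e)) (Unique.cartesianProduct⁺ (Unique.allFin⁺ n) (Unique.allFin⁺ n))

  choices-unique : ∀ i j → Unique (choices i j)
  choices-unique i j = Unique.cartesianProduct⁺ (edges-unique i)
    (Unique.cartesianProduct⁺ (edges-unique j) (((λ ()) ∷ []) ∷ [] ∷ []))

  #crossResults : ∀ {i j} → i ≢ j →
    #distinct _≟ᴬ_ (crossResults (i , j)) ≡ 2 * edgeCount (V i) (G i) * edgeCount (V j) (G j)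
  #crossResults {i} {j} i≢j = begin
    #distinct _≟ᴬ_ (map crossSwitch (choices i j))
      ≡⟨ #distinct-unique _≟ᴬ_ (unique-map⁺ crossSwitch (crossSwitch-injective i≢j) (choices-unique i j)) ⟩
    length (map crossSwitch (choices i j))
      ≡⟨ List.length-map crossSwitch (choices i j) ⟩
    length (choices i j)
      ≡⟨ length-cartesianProduct (edges i) _ ⟩
    eᵢ * length (cartesianProduct (edges j) (true ∷ false ∷ []))
      ≡⟨ cong (eᵢ *_) (length-cartesianProduct (edges j) _) ⟩
    eᵢ * (eⱼ * 2)
      ≡⟨ cong (eᵢ *_) (ℕ.*-comm eⱼ 2) ⟩
    eᵢ * (2 * eⱼ)
      ≡⟨ ℕ.*-assoc eᵢ 2 eⱼ ⟨
    eᵢ * 2 * eⱼ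
      ≡⟨ cong (_* eⱼ) (ℕ.*-comm eᵢ 2) ⟩
    2 * eᵢ * eⱼ ∎
    where
    open ≡-Reasoning
    eᵢ eⱼ : ℕ
    eᵢ = length (edges i)
    eⱼ = length (edges j)

  innerResults-disjoint : ∀ {i i′ z} → z ∈ innerResults i → z ∈ innerResults i′ → i ≡ i′
  innerResults-disjoint z∈ z∈′ =
    let q , ((ca , _) , σ) , z≡q = ∈-innerResults⁻ z∈
        q′ , (q′⊆i′ , _) , z≡q′ = ∈-innerResults⁻ z∈′
    in trans (sym ca) (touches-InComponent q′ q′⊆i′ (switch-≡⇒touches-⊆ q q′ σ (trans (sym z≡q) z≡q′) (inj₁ refl)))

  inner-crossResults-disjoint : ∀ {i i′ j′ z} → i′ ≢ j′ → z ∈ innerResults i → z ∈ crossResults (i′ , j′) → ⊥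
  inner-crossResults-disjoint {i} {i′} {j′} i′≢j′ z∈ z∈′ =
    let q , (q⊆i , _) , z≡q = ∈-innerResults⁻ z∈
        (a′ , _ , c′ , _) , (σ′ , ((ca′ , _) , (cc′ , _))) , z≡q′ = ∈-crossResults⁻ i′≢j′ z∈′
        a′∈q , c′∈q = switch-≡⇒touches-added {X = M} q (TwoSwitch.ac∉X σ′) (trans (sym z≡q) z≡q′)
    in i′≢j′ (begin
      i′      ≡⟨ ca′ ⟨
      comp a′ ≡⟨ touches-InComponent q q⊆i a′∈q ⟩
      i       ≡⟨ touches-InComponent q q⊆i c′∈q ⟨
      comp c′ ≡⟨ cc′ ⟩
      j′      ∎)
    where open ≡-Reasoning

  crossResults-disjoint : ∀ {i j i′ j′ z} → i < j → i′ < j′ →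
    z ∈ crossResults (i , j) → z ∈ crossResults (i′ , j′) → (i , j) ≡ (i′ , j′)
  crossResults-disjoint {i} {j} i<j i′<j′ z∈ z∈′ =
    let q , (_ , q⊆ij) , z≡q = ∈-crossResults⁻ (Fin.<⇒≢ i<j) z∈
        (a′ , _ , c′ , _) , (σ′ , ((ca′ , _) , (cc′ , _))) , z≡q′ = ∈-crossResults⁻ (Fin.<⇒≢ i′<j′) z∈′
        a′∈q , c′∈q = switch-≡⇒touches-added {X = M} q (TwoSwitch.ac∉X σ′) (trans (sym z≡q) z≡q′)
    in sym (sorted-⊆₂⇒≡ i′<j′ i<j
      (subst (_∈₂ (i , j)) ca′ (touches-Straddles q q⊆ij a′∈q))
      (subst (_∈₂ (i , j)) cc′ (touches-Straddles q q⊆ij c′∈q)))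

  isOrdered : Fin k × Fin k → Bool
  isOrdered (i , j) = toℕ i <ᵇ toℕ j

  orderedPairs : List (Fin k × Fin k)
  orderedPairs = filter (λ p → T? (isOrdered p)) (cartesianProduct (allFin k) (allFin k))

  ∈-orderedPairs⁻ : ∀ {i j} → (i , j) ∈ orderedPairs → i < j
  ∈-orderedPairs⁻ {i} {j} p∈ =
    ℕ.<ᵇ⇒< (toℕ i) (toℕ j) (proj₂ (∈-filter⁻ (λ p → T? (isOrdered p)) {xs = cartesianProduct (allFin k) (allFin k)} p∈))

  ∈-orderedPairs⁺ : ∀ {i j} → i < j → (i , j) ∈ orderedPairs
  ∈-orderedPairs⁺ {i} {j} i<j =
    ∈-filter⁺ (λ p → T? (isOrdered p)) (∈-cartesianProduct⁺ (∈-allFin i) (∈-allFin j)) (ℕ.<⇒<ᵇ i<j)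

  orderedPairs-unique : Unique orderedPairs
  orderedPairs-unique = Unique.filter⁺ (λ p → T? (isOrdered p)) (Unique.cartesianProduct⁺ (Unique.allFin⁺ k) (Unique.allFin⁺ k))

  innerPart crossPart : List (Adj n)
  innerPart = concatMap innerResults (allFin k)
  crossPart = concatMap crossResults orderedPairs

  inS-full : ∀ u → T (inS (full {n}) u)
  inS-full u = subst T (sym (lookup∘tabulate (λ _ → true) u)) _

  edge-ab : ∀ {a b c d} → TwoSwitch M a b c d → EdgeOf (comp a) a b
  edge-ab σ = a≢b , refl , sym (comp-adj _ _ ab∈X) , ab∈X
    where open TwoSwitch σ

  edge-cd : ∀ {a b c d} → TwoSwitch M a b c d → EdgeOf (comp c) c d
  edge-cd σ = c≢d , refl , sym (comp-adj _ _ cd∈X) , cd∈X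
    where open TwoSwitch σ

  switch-∈-parts : ∀ {a b c d} → TwoSwitch M a b c d → switch M a b c d ∈ innerPart ++ crossPart
  switch-∈-parts {a} {b} {c} {d} σ with Fin.<-cmp (comp a) (comp c) | edge-ab σ | edge-cd σ
  ... | tri≈ _ ca≡cc _ | _ , _ , cb , _ | _ , _ , cd , _ =
    ∈-++⁺ˡ (∈-concatMap⁺ innerResults (lose (∈-allFin (comp a)) (∈-map⁺ (switchQ M)
      (∈-componentQuads⁺ (a , b , c , d) (refl , cb , sym ca≡cc , trans cd (sym ca≡cc)) σ))))
  ... | tri< ca<cc _ _ | ab | cd = ∈-++⁺ʳ innerPart (∈-concatMap⁺ crossResults (lose (∈-orderedPairs⁺ ca<cc)
    (∈-crossResults⁺ ab cd)))
  ... | tri> _ _ cc<ca | ab | cd = ∈-++⁺ʳ innerPart (∈-concatMap⁺ crossResults (lose (∈-orderedPairs⁺ cc<ca)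
    (subst (_∈ _) (sym (switch-swap-edges M a b c d)) (∈-crossResults⁺ cd ab))))

  switchResults-∼ : switchResults full M ∼[ set ] innerPart ++ crossPart
  switchResults-∼ = mk⇔ to (λ z∈ → [ fromInner , fromCross ]′ (∈-++⁻ innerPart z∈))
    where
    to : ∀ {z} → z ∈ switchResults full M → z ∈ innerPart ++ crossPart
    to z∈ =
      let q , q∈ , z≡q = ∈-map⁻ (switchQ M) z∈
      in subst (_∈ innerPart ++ crossPart) (sym z≡q) (switch-∈-parts (proj₂ (∈-validQuads⁻ {S = full} {X = M} q q∈)))

    valid : ∀ q → IsTwoSwitch M q → switchQ M q ∈ switchResults full M
    valid q@(a , b , c , d) σ = ∈-map⁺ (switchQ M) (∈-validQuads⁺ {S = full} {X = M} q (inS-full a , inS-full b , inS-full c , inS-full d) σ)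

    fromInner : ∀ {z} → z ∈ innerPart → z ∈ switchResults full M
    fromInner z∈ =
      let _ , _ , z∈i = find (∈-concatMap⁻ innerResults {allFin k} z∈)
          q , (_ , σ) , z≡q = ∈-innerResults⁻ z∈i
      in subst (_∈ switchResults full M) (sym z≡q) (valid q σ)

    fromCross : ∀ {z} → z ∈ crossPart → z ∈ switchResults full M
    fromCross z∈ =
      let (i , j) , ij∈ , z∈ij = find (∈-concatMap⁻ crossResults {orderedPairs} z∈)
          q , (σ , _) , z≡q = ∈-crossResults⁻ (Fin.<⇒≢ (∈-orderedPairs⁻ ij∈)) z∈ij
      in subst (_∈ switchResults full M) (sym z≡q) (valid q σ)

  deg-decomposition : deg full M ≡
    sumFin (λ i → deg (V i) (G i)) + sumPairs (λ i j → 2 * edgeCount (V i) (G i) * edgeCount (V j) (G j))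
  deg-decomposition = begin
    deg full M
      ≡⟨ #distinct-cong _≟ᴬ_ switchResults-∼ ⟩
    #distinct _≟ᴬ_ (innerPart ++ crossPart)
      ≡⟨ #distinct-++ _≟ᴬ_ (λ (z∈inner , z∈cross) → parts-disjoint z∈inner z∈cross) ⟩
    #distinct _≟ᴬ_ innerPart + #distinct _≟ᴬ_ crossPart
      ≡⟨ cong₂ _+_ #innerPart #crossPart ⟩
    sumFin (λ i → deg (V i) (G i)) + sumPairs (λ i j → 2 * edgeCount (V i) (G i) * edgeCount (V j) (G j)) ∎
    where
    open ≡-Reasoning
    parts-disjoint : ∀ {z} → z ∈ innerPart → z ∈ crossPart → ⊥
    parts-disjoint z∈inner z∈cross =
      let _ , _ , z∈i = find (∈-concatMap⁻ innerResults {allFin k} z∈inner)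
          (i′ , j′) , ij∈ , z∈ij = find (∈-concatMap⁻ crossResults {orderedPairs} z∈cross)
      in inner-crossResults-disjoint (Fin.<⇒≢ (∈-orderedPairs⁻ ij∈)) z∈i z∈ij

    #innerPart : #distinct _≟ᴬ_ innerPart ≡ sumFin (λ i → deg (V i) (G i))
    #innerPart = trans
      (#distinct-concat _≟ᴬ_ innerResults (Unique.allFin⁺ k) λ _ _ i≢i′ (z∈ , z∈′) → i≢i′ (innerResults-disjoint z∈ z∈′))
      (cong sum (List.map-cong #innerResults (allFin k)))

    #crossPart : #distinct _≟ᴬ_ crossPart ≡ sumPairs (λ i j → 2 * edgeCount (V i) (G i) * edgeCount (V j) (G j))
    #crossPart = trans
      (#distinct-concat _≟ᴬ_ crossResults orderedPairs-unique
        λ ij∈ ij∈′ ij≢ij′ (z∈ , z∈′) →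
          ij≢ij′ (crossResults-disjoint (∈-orderedPairs⁻ ij∈) (∈-orderedPairs⁻ ij∈′) z∈ z∈′))
      (cong sum (List.map-cong-local {xs = orderedPairs} (All.tabulate λ ij∈ → #crossResults (Fin.<⇒≢ (∈-orderedPairs⁻ ij∈)))))

mainTheorem6 : ∀ {n k : ℕ} (M : Adj n) → IsSimple M → 2 ≤ k →
    (comp : Fin n → Fin k) → IsComponentLabelling M comp →
    deg full M ≡
      sumFin (λ i → deg (compVerts comp i) (compAdj M comp i))
      + sumPairs (λ i j → 2 * edgeCount (compVerts comp i) (compAdj M comp i)
                            * edgeCount (compVerts comp j) (compAdj M comp j))
mainTheorem6 M (M-sym , _) _ comp (_ , comp-adj , _) = Components.deg-decomposition M M-sym comp comp-adj
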